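{- Let $\sigma\in\mathfrak S_n$ and $1\le i\le n$ with $i\ne\sigma(i)$. Then $i$ is a right-to-left minimum of $\sigma$ (i.e. $\sigma(i)=\min_{i\le l\le n}\sigma(l)$) if and only if the $i$th step of the Laguerre history $\Psi_{FZ}(\sigma)$ is a type 2 step.
   Context: A Laguerre history of size $n$ is a Motzkin path of $n$ steps (steps $\nearrow,\rightarrow,\searrow$ from height $0$ to height $0$, never below $0$) in which each step carries a weight: a step $\nearrow$ starting at height $h$ has weight $yq^i$ for some $i\in\{0,\dots,h\}$; a step $\rightarrow$ starting at height $h$ has weight either $yq^i$ for some $i\in\{0,\dots,h\}$ or $q^i$ for some $i\in\{0,\dots,h-1\}$; a step $\searrow$ starting at height $h$ has weight $q^i$ for some $i\in\{0,\dots,h-1\}$. A type 1 step is a step with weight $yq^h$, and a type 2 step is a step with weight $q^{h-1}$, where $h$ is its starting height. The Foata–Zeilberger map $\Psi_{FZ}$ sends $\sigma\in\mathfrak S_n$ to the Laguerre history whose $i$th step is $\nearrow$ if $\sigma^{ -1}(i)>i<\sigma(i)$, $\searrow$ if $\sigma^{ -1}(i)<i>\sigma(i)$, and $\rightarrow$ otherwise, with weight $y^\delta q^j$ where $\delta=1$ if $i\le\sigma(i)$ and $0$ otherwise, and $j=\#\{k: k<i\le\sigma(k)<\sigma(i)\}$ if $i\le\sigma(i)$, $j=\#\{k:\sigma(i)<\sigma(k)<i<k\}$ if $\sigma(i)<i$. -}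

module Defs where

open import Data.Nat using (ℕ; zero; suc)
open import Data.Bool using (Bool; true; false; _∧_; if_then_else_)
open import Data.Fin using (Fin; _<_; _≤_; _<?_; _≤?_)
open import Data.Fin.Permutation using (Permutation′; _⟨$⟩ʳ_; _⟨$⟩ˡ_)
open import Data.List using (List; allFin; filter; length)
open import Data.Integer using (ℤ; +_; _-_)
open import Relation.Nullary.Decidable using (⌊_⌋)
open import Relation.Unary using (Pred)
open import Data.Product using (_×_)
open import Relation.Binary.PropositionalEquality using (_≡_)
open import Level using (0ℓ)

-- Permutations of [n] are modelled as permutations of Fin n (0-based;
-- all definitions only compare positions/values, so the shift is harmless).

#[_] : {n : ℕ} → (Fin n → Bool) → ℕ
#[_] {n} P = length (filter (λ k → Data.Bool._≟_ (P k) true) (allFin n))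

data Step : Set where
  up level down : Step

isUp : {n : ℕ} → Permutation′ n → Fin n → Bool
isUp σ i = ⌊ i <? (σ ⟨$⟩ˡ i) ⌋ ∧ ⌊ i <? (σ ⟨$⟩ʳ i) ⌋

isDown : {n : ℕ} → Permutation′ n → Fin n → Bool
isDown σ i = ⌊ (σ ⟨$⟩ˡ i) <? i ⌋ ∧ ⌊ (σ ⟨$⟩ʳ i) <? i ⌋

step : {n : ℕ} → Permutation′ n → Fin n → Step
step σ i = if isUp σ i then up else (if isDown σ i then down else level)

height : {n : ℕ} → Permutation′ n → Fin n → ℤ
height σ i = + #[ (λ k → ⌊ k <? i ⌋ ∧ isUp σ k) ]
           - + #[ (λ k → ⌊ k <? i ⌋ ∧ isDown σ k) ]

-- the exponent j of the weight y^δ q^j of the i-th step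
qexp : {n : ℕ} → Permutation′ n → Fin n → ℕ
qexp σ i = if ⌊ i ≤? (σ ⟨$⟩ʳ i) ⌋
  then #[ (λ k → ⌊ k <? i ⌋ ∧ ⌊ i ≤? (σ ⟨$⟩ʳ k) ⌋ ∧ ⌊ (σ ⟨$⟩ʳ k) <? (σ ⟨$⟩ʳ i) ⌋) ]
  else #[ (λ k → ⌊ (σ ⟨$⟩ʳ i) <? (σ ⟨$⟩ʳ k) ⌋ ∧ ⌊ (σ ⟨$⟩ʳ k) <? i ⌋ ∧ ⌊ i <? k ⌋) ]

-- δ = 1 iff i ≤ σ(i); the weight is y^δ q^(qexp σ i)
-- type 2 step: weight q^(h-1) with h the starting height, i.e. δ = 0 and j = h - 1
Type2 : {n : ℕ} → Permutation′ n → Fin n → Set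
Type2 σ i = ((σ ⟨$⟩ʳ i) < i) × (+ qexp σ i ≡ height σ i - + 1)

RLmin : {n : ℕ} → Permutation′ n → Fin n → Set
RLmin {n} σ i = (l : Fin n) → i ≤ l → (σ ⟨$⟩ʳ i) ≤ (σ ⟨$⟩ʳ l)

-- Cut the positions of σ between i − 1 and i. The height of the i-th step of
-- Ψ_FZ(σ) is the number of arcs k ↦ σ(k) crossing the cut forwards, which by
-- conservation equals the number crossing it backwards. When σ(i) < i, the
-- backward crossings are i itself, the k > i with σ(i) < σ(k) < i (counted by
-- the exponent of the weight) and the k > i with σ(k) < σ(i). Hence the step
-- has type 2 iff no k > i has σ(k) < σ(i), i.e. iff i is a right-to-left
-- minimum; the hypothesis i ≠ σ(i) excludes σ(i) = i, which would be a
-- right-to-left minimum with a weight carrying y.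
module Submission where

open import Defs
open import Data.Nat using (ℕ)
open import Data.Fin using (Fin)
open import Data.Fin.Permutation using (Permutation′; _⟨$⟩ʳ_)
open import Relation.Binary.PropositionalEquality using (_≢_)
open import Function.Bundles using (_⇔_)

open import Algebra.Properties.CommutativeMonoid.Sum as Sum using ()
open import Data.Bool as Bool using (Bool; true; false; not; _∧_)
open import Data.Empty using (⊥-elim)
open import Data.Fin using (zero; suc; toℕ; _<_; _≤_; _<?_; _≤?_; _≟_)
open import Data.Fin.Permutation using (_⟨$⟩ˡ_; inverseˡ; inverseʳ)
open import Data.Fin.Properties using (<-irrefl; <-asym; <-trans; ≤∧≢⇒<; toℕ-injective)
open import Data.Integer as ℤ using (+_; _⊖_)
open import Data.Integer.Properties using ([+m]-[+n]≡m⊖n; ⊖-≥; +-injective)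
open import Data.List using (filter; length; tabulate)
import Data.Nat as ℕ
import Data.Nat.Properties as ℕ
open import Data.Product using (_×_; _,_; proj₂)
open import Function using (_∘_; id; mk⇔; Equivalence; Injection)
open import Function.Properties.Inverse using (↔⇒↣)
open import Relation.Binary.PropositionalEquality
  using (_≡_; _≗_; refl; sym; trans; cong; cong₂; subst; module ≡-Reasoning)
open import Relation.Nullary using (¬_; yes; no)
open import Relation.Nullary.Decidable using (⌊_⌋; ⌊⌋-map′)

open Sum ℕ.+-0-commutativeMonoid using (sum; sum-cong-≗; ∑-distrib-+; ∑-permute; sum-replicate-zero)

private
  variable
    n : ℕ

iverson : Bool → ℕ
iverson false = 0
iverson true  = 1

_<ᵇ_ : Fin n → Fin n → Bool
a <ᵇ b = ⌊ a <? b ⌋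

≮∧≯⇒≡ : {a b : Fin n} → ¬ a < b → ¬ b < a → a ≡ b
≮∧≯⇒≡ a≮b b≮a = toℕ-injective (ℕ.≤-antisym (ℕ.≮⇒≥ b≮a) (ℕ.≮⇒≥ a≮b))

+[m+n]-+n≡+m : ∀ m k → + (m ℕ.+ k) ℤ.- + k ≡ + m
+[m+n]-+n≡+m m k = begin
  + (m ℕ.+ k) ℤ.- + k  ≡⟨ [+m]-[+n]≡m⊖n (m ℕ.+ k) k ⟩
  (m ℕ.+ k) ⊖ k        ≡⟨ ⊖-≥ (ℕ.m≤n+m k m) ⟩
  + (m ℕ.+ k ℕ.∸ k)    ≡⟨ cong +_ (ℕ.m+n∸n≡m m k) ⟩
  + m                  ∎
  where open ≡-Reasoning

count : (Fin n → Bool) → ℕ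
count P = sum (iverson ∘ P)

length-filter-tabulate : ∀ {m} (P : Fin m → Bool) (f : Fin n → Fin m) →
  length (filter (λ k → P k Bool.≟ true) (tabulate f)) ≡ count (P ∘ f)
length-filter-tabulate {n = ℕ.zero}  P f = refl
length-filter-tabulate {n = ℕ.suc n} P f with P (f zero)
... | true  = cong ℕ.suc (length-filter-tabulate P (f ∘ suc))
... | false = length-filter-tabulate P (f ∘ suc)

#[]≡count : (P : Fin n → Bool) → #[ P ] ≡ count P
#[]≡count P = length-filter-tabulate P id

count-cong : {P Q : Fin n → Bool} → P ≗ Q → count P ≡ count Q
count-cong P≗Q = sum-cong-≗ (cong iverson ∘ P≗Q)

count-permute : (π : Permutation′ n) (P : Fin n → Bool) → count P ≡ count (P ∘ (π ⟨$⟩ʳ_))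
count-permute π P = ∑-permute (iverson ∘ P) π

count-split : {P Q R : Fin n → Bool} →
  (∀ k → iverson (P k) ≡ iverson (Q k) ℕ.+ iverson (R k)) → count P ≡ count Q ℕ.+ count R
count-split {Q = Q} {R} split = trans (sum-cong-≗ split) (∑-distrib-+ (iverson ∘ Q) (iverson ∘ R))

count-balance : {P Q R S : Fin n → Bool} →
  (∀ k → iverson (P k) ℕ.+ iverson (Q k) ≡ iverson (R k) ℕ.+ iverson (S k)) →
  count P ℕ.+ count Q ≡ count R ℕ.+ count S
count-balance {P = P} {Q} {R} {S} balance =
  trans (sym (∑-distrib-+ (iverson ∘ P) (iverson ∘ Q)))
        (trans (sum-cong-≗ balance) (∑-distrib-+ (iverson ∘ R) (iverson ∘ S)))

count-false : {P : Fin n → Bool} → (∀ k → P k ≡ false) → count P ≡ 0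
count-false {n = n} P≗false = trans (count-cong P≗false) (sum-replicate-zero n)

count-mono : {P Q : Fin n → Bool} → (∀ k → P k ≡ true → Q k ≡ true) → count P ℕ.≤ count Q
count-mono {n = ℕ.zero}  _   = ℕ.z≤n
count-mono {n = ℕ.suc n} P⇒Q = ℕ.+-mono-≤ (iverson-mono (P⇒Q zero)) (count-mono (P⇒Q ∘ suc))
  where
  iverson-mono : {a b : Bool} → (a ≡ true → b ≡ true) → iverson a ℕ.≤ iverson b
  iverson-mono {false} _   = ℕ.z≤n
  iverson-mono {true}  a⇒b rewrite a⇒b refl = ℕ.≤-refl

count-< : (v : Fin n) → count (_<ᵇ v) ≡ toℕ v
count-< {n = ℕ.suc n} zero    = count-false {n = n} {P = λ k → suc k <ᵇ zero} (λ _ → refl)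
count-< {n = ℕ.suc n} (suc v) = cong ℕ.suc (trans (count-cong suc<suc) (count-< v))
  where
  suc<suc : (k : Fin n) → suc k <ᵇ suc v ≡ k <ᵇ v
  suc<suc k with suc k <? suc v | k <? v
  ... | yes _       | yes _   = refl
  ... | no  _       | no  _   = refl
  ... | yes k+1<v+1 | no k≮v  = ⊥-elim (k≮v (ℕ.s<s⁻¹ k+1<v+1))
  ... | no  k+1≮v+1 | yes k<v = ⊥-elim (k+1≮v+1 (ℕ.s<s k<v))

count-≟ : (i : Fin n) → count (λ k → ⌊ k ≟ i ⌋) ≡ 1
count-≟ {n = ℕ.suc n} zero    = cong ℕ.suc (count-false {n = n} {P = λ k → ⌊ suc k ≟ zero ⌋} (λ _ → refl))
count-≟ {n = ℕ.suc n} (suc i) = trans (count-cong (λ k → ⌊⌋-map′ _ _ (k ≟ i))) (count-≟ i)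

count-pos : {P : Fin n → Bool} (i : Fin n) → P i ≡ true → 1 ℕ.≤ count P
count-pos {P = P} i Pi = subst (ℕ._≤ count P) (count-≟ i) (count-mono only-i)
  where
  only-i : ∀ k → ⌊ k ≟ i ⌋ ≡ true → P k ≡ true
  only-i k _  with k ≟ i
  only-i k _  | yes refl = Pi
  only-i k () | no _

count≡0⇒false : {P : Fin n → Bool} → count P ≡ 0 → ∀ k → P k ≡ false
count≡0⇒false {P = P} count≡0 k with P k in Pk
... | false = refl
... | true  = ⊥-elim (ℕ.n≮0 (subst (1 ℕ.≤_) count≡0 (count-pos k Pk)))

iverson-∧-balance : (c : Bool) {x y z w : Bool} →
  iverson x ℕ.+ iverson y ≡ iverson z ℕ.+ iverson w →
  iverson (c ∧ x) ℕ.+ iverson (c ∧ y) ≡ iverson (c ∧ z) ℕ.+ iverson (c ∧ w)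
iverson-∧-balance false _ = refl
iverson-∧-balance true  e = e

iverson-split-∧ : (a b : Bool) → iverson a ≡ iverson (a ∧ b) ℕ.+ iverson (a ∧ not b)
iverson-split-∧ false _     = refl
iverson-split-∧ true  false = refl
iverson-split-∧ true  true  = refl

iverson-split-∧′ : (a b : Bool) → iverson b ≡ iverson (a ∧ b) ℕ.+ iverson (not a ∧ b)
iverson-split-∧′ false _ = refl
iverson-split-∧′ true  b = sym (ℕ.+-identityʳ (iverson b))

-- With a = σ⁻¹(k), b = σ(k): [step k is ↗] − [step k is ↘] = [k < σ(k)] − [σ⁻¹(k) < k].
up-down-balance : {k a b : Fin n} → (a ≡ k → b ≡ k) → (b ≡ k → a ≡ k) →
  iverson (k <ᵇ a ∧ k <ᵇ b) ℕ.+ iverson (a <ᵇ k) ≡ iverson (k <ᵇ b) ℕ.+ iverson (a <ᵇ k ∧ b <ᵇ k)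
up-down-balance {k = k} {a} {b} a≡k⇒b≡k b≡k⇒a≡k with k <? b | k <? a | a <? k | b <? k
... | _       | yes k<a | yes a<k | _       = ⊥-elim (<-asym k<a a<k)
... | yes k<b | _       | _       | yes b<k = ⊥-elim (<-asym k<b b<k)
... | yes _   | yes _   | no _    | no _    = refl
... | yes _   | no _    | yes _   | no _    = refl
... | no _    | yes _   | no _    | yes _   = refl
... | no _    | no _    | yes _   | yes _   = refl
... | no _    | no _    | no _    | no _    = refl
... | yes k<b | no k≮a  | no a≮k  | no _    = ⊥-elim (<-irrefl (sym (a≡k⇒b≡k (≮∧≯⇒≡ a≮k k≮a))) k<b)
... | no _    | no k≮a  | no a≮k  | yes b<k = ⊥-elim (<-irrefl (a≡k⇒b≡k (≮∧≯⇒≡ a≮k k≮a)) b<k)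
... | no k≮b  | yes k<a | no _    | no b≮k  = ⊥-elim (<-irrefl (sym (b≡k⇒a≡k (≮∧≯⇒≡ b≮k k≮b))) k<a)
... | no k≮b  | no _    | yes a<k | no b≮k  = ⊥-elim (<-irrefl (b≡k⇒a≡k (≮∧≯⇒≡ b≮k k≮b)) a<k)

iverson-<-split : (i k b : Fin n) →
  iverson (k <ᵇ i ∧ k <ᵇ b) ≡ iverson (b <ᵇ i ∧ k <ᵇ b) ℕ.+ iverson (k <ᵇ i ∧ not (b <ᵇ i))
iverson-<-split i k b with k <? i | k <? b | b <? i
... | no k≮i  | yes k<b | yes b<i = ⊥-elim (k≮i (<-trans k<b b<i))
... | yes k<i | no k≮b  | no b≮i  = ⊥-elim (k≮b (ℕ.<-≤-trans k<i (ℕ.≮⇒≥ b≮i)))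
... | no _    | yes _   | no _    = refl
... | no _    | no _    | yes _   = refl
... | no _    | no _    | no _    = refl
... | yes _   | yes _   | yes _   = refl
... | yes _   | yes _   | no _    = refl
... | yes _   | no _    | yes _   = refl

iverson-≮-split : (f : Fin n → Fin n) (i : Fin n) → f i < i → ∀ k →
  iverson (not (k <ᵇ i) ∧ f k <ᵇ i) ≡ iverson ⌊ k ≟ i ⌋ ℕ.+ iverson (i <ᵇ k ∧ f k <ᵇ i)
iverson-≮-split f i fi<i k with k ≟ i
... | yes refl with k <? k | f k <? k
...   | yes k<k | _        = ⊥-elim (<-irrefl refl k<k)
...   | no _    | yes _    = refl
...   | no _    | no fk≮k  = ⊥-elim (fk≮k fi<i)
iverson-≮-split f i fi<i k | no k≢i with k <? i | i <? k
...   | yes k<i | yes i<k = ⊥-elim (<-asym k<i i<k)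
...   | yes _   | no _    = refl
...   | no _    | yes _   = refl
...   | no k≮i  | no i≮k  = ⊥-elim (k≢i (≮∧≯⇒≡ k≮i i≮k))

iverson-right-split : {i k a b : Fin n} → (b ≡ a → k ≡ i) → a < i →
  iverson (i <ᵇ k ∧ b <ᵇ i) ≡ iverson (a <ᵇ b ∧ b <ᵇ i ∧ i <ᵇ k) ℕ.+ iverson (i <ᵇ k ∧ b <ᵇ a)
iverson-right-split {i = i} {k} {a} {b} b≡a⇒k≡i a<i with i <? k | b <? i | a <? b | b <? a
... | _       | _       | yes a<b | yes b<a = ⊥-elim (<-asym a<b b<a)
... | no _    | yes _   | yes _   | no _    = refl
... | no _    | no _    | yes _   | no _    = refl
... | no _    | yes _   | no _    | _       = refl
... | no _    | no _    | no _    | _       = refl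
... | yes _   | yes _   | yes _   | no _    = refl
... | yes _   | yes _   | no _    | yes _   = refl
... | yes _   | no _    | yes _   | no _    = refl
... | yes _   | no _    | no _    | no _    = refl
... | yes i<k | yes _   | no a≮b  | no b≮a  = ⊥-elim (<-irrefl (sym (b≡a⇒k≡i (≮∧≯⇒≡ b≮a a≮b))) i<k)
... | yes _   | no b≮i  | no _    | yes b<a = ⊥-elim (b≮i (<-trans b<a a<i))

module _ (σ : Permutation′ n) where

  forwardCrossings : Fin n → ℕ
  forwardCrossings i = count (λ k → k <ᵇ i ∧ not ((σ ⟨$⟩ʳ k) <ᵇ i))

  backwardCrossings : Fin n → ℕ
  backwardCrossings i = count (λ k → not (k <ᵇ i) ∧ (σ ⟨$⟩ʳ k) <ᵇ i)

  smallerToTheRight : Fin n → ℕ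
  smallerToTheRight i = count (λ k → i <ᵇ k ∧ (σ ⟨$⟩ʳ k) <ᵇ (σ ⟨$⟩ʳ i))

  -- Both sides complete #{k : k < i ∧ σ(k) < i} to #{k : k < i} = #{k : σ(k) < i}.
  forwardCrossings≡backwardCrossings : (i : Fin n) → forwardCrossings i ≡ backwardCrossings i
  forwardCrossings≡backwardCrossings i = ℕ.+-cancelˡ-≡ stay (forwardCrossings i) (backwardCrossings i) (begin
    stay ℕ.+ forwardCrossings i    ≡⟨ count-split (λ k → iverson-split-∧ (k <ᵇ i) ((σ ⟨$⟩ʳ k) <ᵇ i)) ⟨
    count (_<ᵇ i)                  ≡⟨ count-permute σ (_<ᵇ i) ⟩
    count (λ k → (σ ⟨$⟩ʳ k) <ᵇ i)  ≡⟨ count-split (λ k → iverson-split-∧′ (k <ᵇ i) ((σ ⟨$⟩ʳ k) <ᵇ i)) ⟩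
    stay ℕ.+ backwardCrossings i   ∎)
    where
    open ≡-Reasoning
    stay : ℕ
    stay = count (λ k → k <ᵇ i ∧ (σ ⟨$⟩ʳ k) <ᵇ i)

  height≡forwardCrossings : (i : Fin n) → height σ i ≡ + forwardCrossings i
  height≡forwardCrossings i = begin
    height σ i
      ≡⟨ cong₂ (λ u d → + u ℤ.- + d) (#[]≡count up-before) (#[]≡count down-before) ⟩
    + ups ℤ.- + downs
      ≡⟨ cong (λ u → + u ℤ.- + downs) ups≡forward+downs ⟩
    + (forwardCrossings i ℕ.+ downs) ℤ.- + downs
      ≡⟨ +[m+n]-+n≡+m (forwardCrossings i) downs ⟩
    + forwardCrossings i
      ∎
    where
    open ≡-Reasoning
    up-before down-before : Fin n → Bool
    up-before   k = k <ᵇ i ∧ isUp σ k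
    down-before k = k <ᵇ i ∧ isDown σ k

    ups downs rises returns : ℕ
    ups     = count up-before
    downs   = count down-before
    rises   = count (λ k → k <ᵇ i ∧ k <ᵇ (σ ⟨$⟩ʳ k))
    returns = count (λ k → (σ ⟨$⟩ʳ k) <ᵇ i ∧ k <ᵇ (σ ⟨$⟩ʳ k))

    fixedˡ⇒fixedʳ : ∀ {k} → σ ⟨$⟩ˡ k ≡ k → σ ⟨$⟩ʳ k ≡ k
    fixedˡ⇒fixedʳ {k} e = trans (sym (cong (σ ⟨$⟩ʳ_) e)) (inverseʳ σ)

    fixedʳ⇒fixedˡ : ∀ {k} → σ ⟨$⟩ʳ k ≡ k → σ ⟨$⟩ˡ k ≡ k
    fixedʳ⇒fixedˡ {k} e = trans (sym (cong (σ ⟨$⟩ˡ_) e)) (inverseˡ σ)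

    steps-balance : ups ℕ.+ count (λ k → k <ᵇ i ∧ (σ ⟨$⟩ˡ k) <ᵇ k) ≡ rises ℕ.+ downs
    steps-balance = count-balance (λ k → iverson-∧-balance (k <ᵇ i) (up-down-balance fixedˡ⇒fixedʳ fixedʳ⇒fixedˡ))

    falls≡returns : count (λ k → k <ᵇ i ∧ (σ ⟨$⟩ˡ k) <ᵇ k) ≡ returns
    falls≡returns = trans (count-permute σ _)
      (count-cong (λ k → cong (λ x → (σ ⟨$⟩ʳ k) <ᵇ i ∧ x <ᵇ (σ ⟨$⟩ʳ k)) (inverseˡ σ)))

    rises≡returns+forward : rises ≡ returns ℕ.+ forwardCrossings i
    rises≡returns+forward = count-split (λ k → iverson-<-split i k (σ ⟨$⟩ʳ k))

    ups≡forward+downs : ups ≡ forwardCrossings i ℕ.+ downs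
    ups≡forward+downs = ℕ.+-cancelʳ-≡ returns ups (forwardCrossings i ℕ.+ downs) (begin
      ups ℕ.+ returns                             ≡⟨ cong (ups ℕ.+_) falls≡returns ⟨
      ups ℕ.+ _                                   ≡⟨ steps-balance ⟩
      rises ℕ.+ downs                             ≡⟨ cong (ℕ._+ downs) rises≡returns+forward ⟩
      returns ℕ.+ forwardCrossings i ℕ.+ downs    ≡⟨ ℕ.+-assoc returns _ downs ⟩
      returns ℕ.+ (forwardCrossings i ℕ.+ downs)  ≡⟨ ℕ.+-comm returns _ ⟩
      forwardCrossings i ℕ.+ downs ℕ.+ returns    ∎)

  qexp-descent : {i : Fin n} → σ ⟨$⟩ʳ i < i →
    qexp σ i ≡ count (λ k → (σ ⟨$⟩ʳ i) <ᵇ (σ ⟨$⟩ʳ k) ∧ (σ ⟨$⟩ʳ k) <ᵇ i ∧ i <ᵇ k)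
  qexp-descent {i} σi<i with i ≤? σ ⟨$⟩ʳ i
  ... | yes i≤σi = ⊥-elim (ℕ.<-irrefl refl (ℕ.<-≤-trans σi<i i≤σi))
  ... | no _     = #[]≡count (λ k → (σ ⟨$⟩ʳ i) <ᵇ (σ ⟨$⟩ʳ k) ∧ (σ ⟨$⟩ʳ k) <ᵇ i ∧ i <ᵇ k)

  backwardCrossings-descent : {i : Fin n} → σ ⟨$⟩ʳ i < i →
    backwardCrossings i ≡ ℕ.suc (qexp σ i ℕ.+ smallerToTheRight i)
  backwardCrossings-descent {i} σi<i = begin
    backwardCrossings i
      ≡⟨ count-split (iverson-≮-split (σ ⟨$⟩ʳ_) i σi<i) ⟩
    count (λ k → ⌊ k ≟ i ⌋) ℕ.+ count (λ k → i <ᵇ k ∧ (σ ⟨$⟩ʳ k) <ᵇ i)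
      ≡⟨ cong₂ ℕ._+_ (count-≟ i) (count-split (λ k → iverson-right-split {k = k} (Injection.injective (↔⇒↣ σ)) σi<i)) ⟩
    ℕ.suc (count (λ k → (σ ⟨$⟩ʳ i) <ᵇ (σ ⟨$⟩ʳ k) ∧ (σ ⟨$⟩ʳ k) <ᵇ i ∧ i <ᵇ k) ℕ.+ smallerToTheRight i)
      ≡⟨ cong (λ q → ℕ.suc (q ℕ.+ smallerToTheRight i)) (qexp-descent σi<i) ⟨
    ℕ.suc (qexp σ i ℕ.+ smallerToTheRight i)
      ∎
    where open ≡-Reasoning

  height-descent : {i : Fin n} → σ ⟨$⟩ʳ i < i →
    height σ i ℤ.- + 1 ≡ + (qexp σ i ℕ.+ smallerToTheRight i)
  height-descent {i} σi<i = cong (ℤ._- + 1) (begin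
    height σ i                                  ≡⟨ height≡forwardCrossings i ⟩
    + forwardCrossings i                        ≡⟨ cong +_ (forwardCrossings≡backwardCrossings i) ⟩
    + backwardCrossings i                       ≡⟨ cong +_ (backwardCrossings-descent σi<i) ⟩
    + ℕ.suc (qexp σ i ℕ.+ smallerToTheRight i)  ∎)
    where open ≡-Reasoning

  Type2⇔descent×noSmallerToTheRight : (i : Fin n) →
    Type2 σ i ⇔ (σ ⟨$⟩ʳ i < i × smallerToTheRight i ≡ 0)
  Type2⇔descent×noSmallerToTheRight i = mk⇔
    (λ (σi<i , q≡h-1) → σi<i , ℕ.+-cancelˡ-≡ (qexp σ i) _ 0
      (trans (sym (+-injective (trans q≡h-1 (height-descent σi<i)))) (sym (ℕ.+-identityʳ (qexp σ i)))))
    (λ (σi<i , r≡0) → σi<i , sym (trans (height-descent σi<i)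
      (cong +_ (trans (cong (qexp σ i ℕ.+_) r≡0) (ℕ.+-identityʳ _)))))

  RLmin⇒σi≤i : {i : Fin n} → RLmin σ i → σ ⟨$⟩ʳ i ≤ i
  RLmin⇒σi≤i {i} rl = begin
    toℕ (σ ⟨$⟩ʳ i)                          ≡⟨ count-< (σ ⟨$⟩ʳ i) ⟨
    count (_<ᵇ (σ ⟨$⟩ʳ i))                  ≡⟨ count-permute σ _ ⟩
    count (λ k → (σ ⟨$⟩ʳ k) <ᵇ (σ ⟨$⟩ʳ i))  ≤⟨ count-mono smaller⇒left ⟩
    count (_<ᵇ i)                           ≡⟨ count-< i ⟩
    toℕ i                                   ∎
    where
    open ℕ.≤-Reasoning
    smaller⇒left : ∀ k → (σ ⟨$⟩ʳ k) <ᵇ (σ ⟨$⟩ʳ i) ≡ true → k <ᵇ i ≡ true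
    smaller⇒left k with σ ⟨$⟩ʳ k <? σ ⟨$⟩ʳ i | k <? i
    ... | _         | yes _  = λ _ → refl
    ... | no _      | no _   = λ ()
    ... | yes σk<σi | no k≮i = ⊥-elim (ℕ.<-irrefl refl (ℕ.<-≤-trans σk<σi (rl k (ℕ.≮⇒≥ k≮i))))

  RLmin⇔noSmallerToTheRight : (i : Fin n) → RLmin σ i ⇔ smallerToTheRight i ≡ 0
  RLmin⇔noSmallerToTheRight i = mk⇔
    (λ rl → count-false (RLmin⇒noSmaller rl))
    (noSmaller⇒RLmin ∘ count≡0⇒false)
    where
    RLmin⇒noSmaller : RLmin σ i → ∀ k → i <ᵇ k ∧ (σ ⟨$⟩ʳ k) <ᵇ (σ ⟨$⟩ʳ i) ≡ false
    RLmin⇒noSmaller rl k with i <? k | σ ⟨$⟩ʳ k <? σ ⟨$⟩ʳ i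
    ... | no _    | _         = refl
    ... | yes _   | no _      = refl
    ... | yes i<k | yes σk<σi = ⊥-elim (ℕ.<-irrefl refl (ℕ.<-≤-trans σk<σi (rl k (ℕ.<⇒≤ i<k))))

    noSmaller⇒RLmin : (∀ k → i <ᵇ k ∧ (σ ⟨$⟩ʳ k) <ᵇ (σ ⟨$⟩ʳ i) ≡ false) → RLmin σ i
    noSmaller⇒RLmin none l i≤l with l ≟ i
    ... | yes refl = ℕ.≤-refl
    ... | no l≢i with i <? l | σ ⟨$⟩ʳ l <? σ ⟨$⟩ʳ i | none l
    ...   | no i≮l | _         | _  = ⊥-elim (i≮l (≤∧≢⇒< i≤l (l≢i ∘ sym)))
    ...   | yes _  | no σl≮σi  | _  = ℕ.≮⇒≥ σl≮σi
    ...   | yes _  | yes _     | ()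

lemma3p6 : (n : ℕ) (σ : Permutation′ n) (i : Fin n) → i ≢ σ ⟨$⟩ʳ i →
    (RLmin σ i ⇔ Type2 σ i)
lemma3p6 n σ i i≢σi = mk⇔
  (λ rl → Equivalence.from (Type2⇔descent×noSmallerToTheRight σ i)
    (≤∧≢⇒< (RLmin⇒σi≤i σ rl) (i≢σi ∘ sym) , Equivalence.to (RLmin⇔noSmallerToTheRight σ i) rl))
  (λ type2 → Equivalence.from (RLmin⇔noSmallerToTheRight σ i)
    (proj₂ (Equivalence.to (Type2⇔descent×noSmallerToTheRight σ i) type2)))
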